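{- Let $S$ be a spider with legs $L_1,L_2,\ldots,L_s$, and let $\ell_i=|E(L_i)|$ for each $i\in[1,s]$. Suppose that $\ell_{i+1}\geq 2\ell_i+2$ for every $i\in[2,s-1]$, and that $\ell_2\geq 2\ell_1+2$ if $\ell_2\not\equiv 1 \pmod 4$ and $\ell_2\geq 2\ell_1+4$ otherwise. Then $S$ is graceful.
   Context: For integers $p,q$, $[p,q]=\{i\in\mathbb{Z}: p\le i\le q\}$. A graceful labeling of a graph $G$ is an injective function $f:V(G)\to[0,|E(G)|]$ such that $\{|f(x)-f(y)| : xy\in E(G)\}=[1,|E(G)|]$; $G$ is graceful if it admits one. A spider is a tree with at most one vertex of degree greater than two; when such a vertex exists it is the center, and each path in the spider joining the center to a leaf is called a leg. A leg's length is its number of edges. -}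

module Defs where

open import Data.Nat using (ℕ; zero; suc; _+_; _≤_; ∣_-_∣)
open import Data.Fin using (Fin; zero; suc; inject₁)
open import Data.Maybe using (Maybe; nothing; just)
open import Data.Product using (Σ; _×_; _,_; ∃)
open import Relation.Binary.PropositionalEquality using (_≡_)
open import Function.Definitions using (Injective)

record GracefulLabeling (V E : Set) (ends : E → V × V) (m : ℕ) : Set where
  field
    f        : V → ℕ
    injective : Injective _≡_ _≡_ f
    bounded  : ∀ v → f v ≤ m
    diff-in  : ∀ e → let (x , y) = ends e in 1 ≤ ∣ f x - f y ∣ × ∣ f x - f y ∣ ≤ m
    diff-onto : ∀ k → 1 ≤ k → k ≤ m → ∃ λ e → let (x , y) = ends e in ∣ f x - f y ∣ ≡ k

-- Vertices: the center (nothing) and, for each leg i, the vertices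
-- (i , j) with j : Fin (ℓ i), where (i , j) is at distance j+1 from the center.
SpiderV : (s : ℕ) → (Fin s → ℕ) → Set
SpiderV s ℓ = Maybe (Σ (Fin s) λ i → Fin (ℓ i))

-- Edges: indexed by the non-center vertices; edge (i , j) joins vertex (i , j)
-- to its neighbour one step closer to the center.
SpiderE : (s : ℕ) → (Fin s → ℕ) → Set
SpiderE s ℓ = Σ (Fin s) λ i → Fin (ℓ i)

predPos : {n : ℕ} → Fin n → Maybe (Fin n)
predPos zero    = nothing
predPos (suc k) = just (inject₁ k)

spiderEnds : (s : ℕ) (ℓ : Fin s → ℕ) → SpiderE s ℓ → SpiderV s ℓ × SpiderV s ℓ
spiderEnds s ℓ (i , j) with predPos j
... | nothing = nothing , just (i , j)
... | just k  = just (i , k) , just (i , j)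

legSum : (s : ℕ) → (Fin s → ℕ) → ℕ
legSum zero    ℓ = 0
legSum (suc s) ℓ = ℓ zero + legSum s (λ i → ℓ (suc i))

SpiderGraceful : (s : ℕ) → (Fin s → ℕ) → Set
SpiderGraceful s ℓ = GracefulLabeling (SpiderV s ℓ) (SpiderE s ℓ) (spiderEnds s ℓ) (legSum s ℓ)

module Submission where

open import Defs
open import Data.Nat using (ℕ; suc; _+_; _*_; _≤_; _%_)
open import Data.Fin using (Fin; zero; suc; inject₁)
open import Relation.Binary.PropositionalEquality using (_≡_; _≢_)

open import Data.Bool using (Bool; true; false; not; _xor_)
open import Data.Bool.Properties using (not-involutive; not-injective; not-distribˡ-xor; xor-annihilates-not)
open import Data.Nat
  using (zero; z≤n; s≤s; s≤s⁻¹; z<s; _∸_; _<_; _≮_; pred; ⌊_/2⌋; ⌈_/2⌉; ∣_-_∣; _<?_; _≟_; _≤?_)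
open import Data.Nat.Properties
open import Data.Nat.Induction using (<-rec)
open import Data.Nat.Tactic.RingSolver using (solve-∀)
open import Data.Fin using (toℕ; fromℕ; fromℕ<)
open import Data.Fin.Properties using (toℕ-injective; toℕ-inject₁; toℕ<n; toℕ-fromℕ<)
open import Data.Fin.Relation.Unary.Top using (View; view; ‵fromℕ; ‵inj₁; view-fromℕ; view-inject₁)
open import Data.Maybe using (Maybe; nothing; just)
open import Data.Product using (Σ; _×_; _,_; proj₁; proj₂; ∃-syntax)
open import Data.Sum using (_⊎_; inj₁; inj₂)
open import Data.Empty using (⊥-elim)
open import Function using (_∘_; id)
open import Relation.Nullary using (¬_; Dec; yes; no)
open import Relation.Binary.PropositionalEquality

-- A split labeling of a bipartite graph indexes each colour class injectively from 0
-- and makes the edge sums idx u + idx v run exactly through 0, …, |E| − 1; labelling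
-- one class by idx and the other by |E| − idx is then graceful. Split labelings of the
-- spider are built leg by leg, shortest leg first. If the centre has index x in its
-- class of size c, the next leg (of length L) is a split labeling of a path whose first
-- vertex has index h = c − 1 − x, shifted past the old classes: with |E| old edges, the
-- edge at the centre gets sum |E| and the leg's edges get |E| + 1, |E| + 2, …. Such path
-- labelings are obtained for every L ≥ 2h + 1 other than L = 4h + 1 with h > 0, by
-- concatenating zigzags h, h, h − 1, h − 1, …, 0 and taking mirror images
-- (index ↦ class size − 1 − index). Mirroring the spider's labeling when x is small
-- ensures 2h + 1 ≤ c ≤ previous leg, so ℓᵢ₊₁ ≥ 2ℓᵢ + 2 gives L ≥ 4h + 4.

-- Split labelings of paths

odd : ℕ → Bool
odd zero    = false
odd (suc n) = not (odd n)

-- classSize n c counts the t < n with odd t ≡ c.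
classSize : ℕ → Bool → ℕ
classSize n false = ⌈ n /2⌉
classSize n true  = ⌊ n /2⌋

xor-cancelˡ : ∀ a b → a xor (a xor b) ≡ b
xor-cancelˡ false b = refl
xor-cancelˡ true  b = not-involutive b

odd-+ : ∀ m n → odd (m + n) ≡ odd m xor odd n
odd-+ zero    n = refl
odd-+ (suc m) n = trans (cong not (odd-+ m n)) (not-distribˡ-xor (odd m) (odd n))

classSize-+2 : ∀ n c → classSize (suc (suc n)) c ≡ suc (classSize n c)
classSize-+2 n false = refl
classSize-+2 n true  = refl

classSize-complement : ∀ n c → classSize n c + classSize n (not c) ≡ n
classSize-complement n false = trans (+-comm ⌈ n /2⌉ ⌊ n /2⌋) (⌊n/2⌋+⌈n/2⌉≡n n)
classSize-complement n true  = ⌊n/2⌋+⌈n/2⌉≡n n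

classSize-double : ∀ h c → classSize (h + h) c ≡ h
classSize-double h false = sym (n≡⌈n+n/2⌉ h)
classSize-double h true  = sym (n≡⌊n+n/2⌋ h)

classSize-+ : ∀ m n c → classSize (m + n) c ≡ classSize m c + classSize n (odd m xor c)
classSize-+ zero    n false = refl
classSize-+ zero    n true  = refl
classSize-+ (suc m) n false =
  cong suc (trans (classSize-+ m n true) (cong (λ c → ⌊ m /2⌋ + classSize n c) (sym (xor-annihilates-not (odd m) true))))
classSize-+ (suc m) n true  =
  trans (classSize-+ m n false) (cong (λ c → ⌈ m /2⌉ + classSize n c) (sym (xor-annihilates-not (odd m) false)))

classSize-last : ∀ n → classSize (suc n) (odd n) ≡ ⌈ suc n /2⌉
classSize-last zero          = refl
classSize-last (suc zero)    = refl
classSize-last (suc (suc n)) = begin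
  classSize (suc (suc (suc n))) (not (not (odd n))) ≡⟨ cong (classSize _) (not-involutive (odd n)) ⟩
  classSize (suc (suc (suc n))) (odd n)             ≡⟨ classSize-+2 (suc n) (odd n) ⟩
  suc (classSize (suc n) (odd n))                   ≡⟨ cong suc (classSize-last n) ⟩
  ⌈ suc (suc (suc n)) /2⌉                           ∎
  where open ≡-Reasoning

parity-half-injective : ∀ {t u} → odd t ≡ odd u → ⌊ t /2⌋ ≡ ⌊ u /2⌋ → t ≡ u
parity-half-injective {zero}        {zero}        _ _ = refl
parity-half-injective {suc zero}    {suc zero}    _ _ = refl
parity-half-injective {suc (suc t)} {suc (suc u)} o e =
  cong (2 +_) (parity-half-injective (not-injective (not-injective o)) (suc-injective e))
parity-half-injective {zero}        {suc zero}    ()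
parity-half-injective {suc zero}    {zero}        ()
parity-half-injective {zero}        {suc (suc u)} _ ()
parity-half-injective {suc zero}    {suc (suc u)} _ ()
parity-half-injective {suc (suc t)} {zero}        _ ()
parity-half-injective {suc (suc t)} {suc zero}    _ ()

n≤⌈n/2⌉+⌈n/2⌉ : ∀ n → n ≤ ⌈ n /2⌉ + ⌈ n /2⌉
n≤⌈n/2⌉+⌈n/2⌉ n =
  subst (_≤ ⌈ n /2⌉ + ⌈ n /2⌉) (⌊n/2⌋+⌈n/2⌉≡n n) (+-monoˡ-≤ ⌈ n /2⌉ (⌊n/2⌋≤⌈n/2⌉ n))

⌈n/2⌉+⌈n/2⌉≤1+n : ∀ n → ⌈ n /2⌉ + ⌈ n /2⌉ ≤ suc n
⌈n/2⌉+⌈n/2⌉≤1+n zero          = z≤n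
⌈n/2⌉+⌈n/2⌉≤1+n (suc zero)    = s≤s (s≤s z≤n)
⌈n/2⌉+⌈n/2⌉≤1+n (suc (suc n)) =
  s≤s (subst (_≤ suc (suc n)) (sym (+-suc ⌈ n /2⌉ ⌈ n /2⌉)) (s≤s (⌈n/2⌉+⌈n/2⌉≤1+n n)))

⌈n/2⌉+classSize-odd≡n : ∀ n → ⌈ n /2⌉ + classSize n (odd n) ≡ n
⌈n/2⌉+classSize-odd≡n zero    = refl
⌈n/2⌉+classSize-odd≡n (suc n) =
  trans (cong (_+ classSize (suc n) (not (odd n))) (sym (classSize-last n))) (classSize-complement (suc n) (odd n))

mirror< : ∀ {x C} → x < C → C ∸ suc x < C
mirror< x<C = ∸-monoʳ-< z<s x<C

mirror-injective : ∀ {x y C} → x < C → y < C → C ∸ suc x ≡ C ∸ suc y → x ≡ y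
mirror-injective x<C y<C eq = suc-injective (∸-cancelˡ-≡ x<C y<C eq)

mirror-pair : ∀ {x y C} → x + suc y ≡ C → C ∸ suc x ≡ y
mirror-pair {x} {y} refl = trans (cong (_∸ suc x) (+-suc x y)) (m+n∸m≡n (suc x) y)

pair-sum< : ∀ {x y a b} → x < a → y < b → suc (suc (x + y)) ≤ a + b
pair-sum< {x} {y} {a} {b} x<a y<b = subst (_≤ a + b) (cong suc (+-suc x y)) (+-mono-≤ x<a y<b)

mirror-sum : ∀ {x y a b} → x < a → y < b → (a ∸ suc x) + (b ∸ suc y) + suc (suc (x + y)) ≡ a + b
mirror-sum {x} {y} {a} {b} x<a y<b = begin
  (a ∸ suc x) + (b ∸ suc y) + suc (suc (x + y)) ≡⟨ regroup (a ∸ suc x) (b ∸ suc y) x y ⟩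
  ((a ∸ suc x) + suc x) + ((b ∸ suc y) + suc y) ≡⟨ cong₂ _+_ (m∸n+n≡m x<a) (m∸n+n≡m y<b) ⟩
  a + b                                         ∎
  where
  open ≡-Reasoning
  regroup : ∀ p r x y → p + r + suc (suc (x + y)) ≡ (p + suc x) + (r + suc y)
  regroup = solve-∀

≮∧≢⇒> : ∀ {m n} → m ≮ n → m ≢ n → n < m
≮∧≢⇒> m≮n m≢n = ≤∧≢⇒< (≮⇒≥ m≮n) (≢-sym m≢n)

shifted< : ∀ {N r L} → N ≤ r → suc r < N + L → suc (r ∸ N) < L
shifted< {N} {r} {L} N≤r r< = +-cancelˡ-< N _ L (subst (_< N + L) r+1≡ r<)
  where
  r+1≡ : suc r ≡ N + suc (r ∸ N)
  r+1≡ = trans (cong suc (sym (m+[n∸m]≡n N≤r))) (sym (+-suc N (r ∸ N)))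

complement : ∀ {s N} → suc s < N → ∃[ x ] suc x < N × (∀ {a} → a + suc (suc x) ≡ N → a ≡ s)
complement {s} {N} s<N = x , x<N , λ {a} eq → +-cancelʳ-≡ _ a s (trans eq (sym s+x))
  where
  x : ℕ
  x = N ∸ suc (suc s)
  s+x : s + suc (suc x) ≡ N
  s+x = trans (swap s x) (m∸n+n≡m s<N)
    where
    swap : ∀ s x → s + suc (suc x) ≡ x + suc (suc s)
    swap = solve-∀
  x<N : suc x < N
  x<N = subst (suc (suc x) ≤_) s+x (m≤n+m (suc (suc x)) s)

complement-unique : ∀ {a b x y N} → a + suc (suc x) ≡ N → b + suc (suc y) ≡ N → a ≡ b → x ≡ y
complement-unique {a} refl eq refl = suc-injective (suc-injective (+-cancelˡ-≡ a _ _ (sym eq)))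

-- Vertex t of the path 0 — 1 — ⋯ — (n − 1) has index q t in the parity class odd t. The
-- last vertex carries the mirror image ⌈n/2⌉ − 1 − h of the first one's index h: this is
-- what makes the edge joining two such paths fit between their sums (sum-bridge in concat).
record PathLabeling (n h : ℕ) : Set where
  field
    q             : ℕ → ℕ
    q-head        : q 0 ≡ h
    q-last        : q (pred n) + suc h ≡ ⌈ n /2⌉
    q<classSize   : ∀ {t} → t < n → q t < classSize n (odd t)
    q-injective   : ∀ {t u} → t < n → u < n → odd t ≡ odd u → q t ≡ q u → t ≡ u
    sum-injective : ∀ {t u} → suc t < n → suc u < n → q t + q (suc t) ≡ q u + q (suc u) → t ≡ u
    sum-onto      : ∀ {s} → suc s < n → ∃[ t ] suc t < n × q t + q (suc t) ≡ s

  sum-bound : ∀ {t} → suc t < n → suc (suc (q t + q (suc t))) ≤ n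
  sum-bound {t} t+1<n = subst (_ ≤_) (classSize-complement n (odd t))
    (pair-sum< (q<classSize (<-trans (n<1+n t) t+1<n)) (q<classSize t+1<n))

  length-pos : 0 < n
  length-pos = positive n q-last
    where
    positive : ∀ k → q (pred k) + suc h ≡ ⌈ k /2⌉ → 0 < k
    positive zero    eq = ⊥-elim (m+1+n≢0 (q 0) eq)
    positive (suc k) _  = s≤s z≤n

mirrorPath : ∀ {n h} → PathLabeling n h → PathLabeling n (⌈ n /2⌉ ∸ suc h)
mirrorPath {n} {h} P = record
  { q             = q′
  ; q-head        = cong (λ x → ⌈ n /2⌉ ∸ suc x) q-head
  ; q-last        = q′-last n length-pos q-last
  ; q<classSize   = λ t<n → mirror< (q<classSize t<n)
  ; q-injective   = λ {t} {u} t<n u<n o eq → q-injective t<n u<n o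
                      (mirror-injective (q<classSize t<n) (subst (λ c → q u < classSize n c) (sym o) (q<classSize u<n))
                        (trans eq (cong (λ c → classSize n c ∸ suc (q u)) (sym o))))
  ; sum-injective = λ t<n u<n eq → sum-injective t<n u<n (complement-unique (sums t<n) (sums u<n) eq)
  ; sum-onto      = onto
  }
  where
  open PathLabeling P
  q′ : ℕ → ℕ
  q′ t = classSize n (odd t) ∸ suc (q t)

  q′-last : ∀ k → 0 < k → q (pred k) + suc h ≡ ⌈ k /2⌉ →
            classSize k (odd (pred k)) ∸ suc (q (pred k)) + suc (⌈ k /2⌉ ∸ suc h) ≡ ⌈ k /2⌉
  q′-last (suc k) _ last rewrite classSize-last k | mirror-pair last =
    trans (+-suc h _) (m+[n∸m]≡n (subst (suc h ≤_) last (m≤n+m (suc h) (q k))))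

  sums : ∀ {t} → suc t < n → q′ t + q′ (suc t) + suc (suc (q t + q (suc t))) ≡ n
  sums {t} t+1<n = trans (mirror-sum (q<classSize (<-trans (n<1+n t) t+1<n)) (q<classSize t+1<n))
                         (classSize-complement n (odd t))

  onto : ∀ {s} → suc s < n → ∃[ t ] suc t < n × q′ t + q′ (suc t) ≡ s
  onto s+1<n with complement s+1<n
  ... | x , x+1<n , unique with sum-onto x+1<n
  ...   | t , t+1<n , refl = t , t+1<n , unique (sums t+1<n)

zigzag : ℕ → ℕ → ℕ
zigzag h t = h ∸ ⌊ t /2⌋

monus-sum : ∀ {a b h} → a ≤ h → b ≤ h → (h ∸ a) + (h ∸ b) ≡ (h + h) ∸ (a + b)
monus-sum {a} {b} {h} a≤h b≤h = +-cancelʳ-≡ (a + b) _ _ (begin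
  (h ∸ a) + (h ∸ b) + (a + b)   ≡⟨ regroup (h ∸ a) (h ∸ b) a b ⟩
  ((h ∸ a) + a) + ((h ∸ b) + b) ≡⟨ cong₂ _+_ (m∸n+n≡m a≤h) (m∸n+n≡m b≤h) ⟩
  h + h                         ≡⟨ sym (m∸n+n≡m (+-mono-≤ a≤h b≤h)) ⟩
  (h + h) ∸ (a + b) + (a + b)   ∎)
  where
  open ≡-Reasoning
  regroup : ∀ x y a b → x + y + (a + b) ≡ (x + a) + (y + b)
  regroup = solve-∀

⌊t/2⌋≤h : ∀ {t h} → t ≤ suc (h + h) → ⌊ t /2⌋ ≤ h
⌊t/2⌋≤h {h = h} t≤ = subst (_ ≤_) (sym (n≡⌈n+n/2⌉ h)) (⌊n/2⌋-mono t≤)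

zigzag-sum : ∀ {t h} → t ≤ h + h → zigzag h t + zigzag h (suc t) ≡ (h + h) ∸ t
zigzag-sum {t} t≤ = trans (monus-sum (⌊t/2⌋≤h (m≤n⇒m≤1+n t≤)) (⌊t/2⌋≤h (s≤s t≤)))
                           (cong (_ ∸_) (⌊n/2⌋+⌈n/2⌉≡n t))

zigzag-injective : ∀ {t u h} → t ≤ suc (h + h) → u ≤ suc (h + h) → odd t ≡ odd u →
                    zigzag h t ≡ zigzag h u → t ≡ u
zigzag-injective t≤ u≤ o eq = parity-half-injective o (∸-cancelˡ-≡ (⌊t/2⌋≤h t≤) (⌊t/2⌋≤h u≤) eq)

zigzag-last : ∀ h → zigzag h (suc (h + h)) ≡ 0
zigzag-last h = trans (cong (h ∸_) (sym (n≡⌈n+n/2⌉ h))) (n∸n≡0 h)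

zigzag-even : ∀ h → PathLabeling (suc (suc (h + h))) h
zigzag-even h = record
  { q             = zigzag h
  ; q-head        = refl
  ; q-last        = trans (+-suc (zigzag h (suc (h + h))) h) (cong suc (trans (cong (_+ h) (zigzag-last h)) (n≡⌈n+n/2⌉ h)))
  ; q<classSize   = λ {t} _ → subst (zigzag h t <_) (sym (classSize≡ (odd t))) (s≤s (m∸n≤m h ⌊ t /2⌋))
  ; q-injective   = λ t<n u<n → zigzag-injective (s≤s⁻¹ t<n) (s≤s⁻¹ u<n)
  ; sum-injective = λ t<n u<n eq → ∸-cancelˡ-≡ (bound t<n) (bound u<n)
                                     (trans (sym (zigzag-sum (bound t<n))) (trans eq (zigzag-sum (bound u<n))))
  ; sum-onto      = λ {s} s<n → (h + h) ∸ s , s≤s (s≤s (m∸n≤m (h + h) s)) ,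
                                 trans (zigzag-sum (m∸n≤m (h + h) s)) (m∸[m∸n]≡n (bound s<n))
  }
  where
  bound : ∀ {t} → suc t < suc (suc (h + h)) → t ≤ h + h
  bound = s≤s⁻¹ ∘ s≤s⁻¹
  classSize≡ : ∀ c → classSize (suc (suc (h + h))) c ≡ suc h
  classSize≡ c = trans (classSize-+2 (h + h) c) (cong suc (classSize-double h c))

zigzag-odd : ∀ h → PathLabeling (suc (h + h)) h
zigzag-odd h = record
  { q             = q
  ; q-head        = refl
  ; q-last        = trans (+-suc (zigzag h (suc (h + h))) h) (cong suc (trans (cong (_+ h) (zigzag-last h)) (n≡⌊n+n/2⌋ h)))
  ; q<classSize   = q<classSize
  ; q-injective   = λ t<n u<n o eq → suc-injective (zigzag-injective t<n u<n (cong not o) eq)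
  ; sum-injective = λ t<n u<n eq → suc-injective (∸-cancelˡ-≡ (s≤s⁻¹ t<n) (s≤s⁻¹ u<n)
                                     (trans (sym (zigzag-sum (s≤s⁻¹ t<n))) (trans eq (zigzag-sum (s≤s⁻¹ u<n)))))
  ; sum-onto      = λ {s} s<n → (h + h) ∸ suc s , s≤s (mirror< (s≤s⁻¹ s<n)) ,
                                 trans (zigzag-sum (mirror< (s≤s⁻¹ s<n))) (mirror-pair (m∸n+n≡m (s≤s⁻¹ s<n)))
  }
  where
  q : ℕ → ℕ
  q t = zigzag h (suc t)
  h≤classSize : ∀ c → h ≤ classSize (suc (h + h)) c
  h≤classSize false = ≤-trans (n≤1+n h) (s≤s (≤-reflexive (n≡⌊n+n/2⌋ h)))
  h≤classSize true  = ≤-reflexive (n≡⌈n+n/2⌉ h)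
  q<classSize : ∀ {t} → t < suc (h + h) → q t < classSize (suc (h + h)) (odd t)
  q<classSize {zero}  _   = s≤s (≤-reflexive (n≡⌊n+n/2⌋ h))
  q<classSize {suc t} t<n = <-≤-trans (∸-suc< (positive t<n)) (h≤classSize (odd (suc t)))
    where
    positive : ∀ {t k} → suc t < suc (k + k) → 0 < k
    positive {k = zero}  (s≤s ())
    positive {k = suc k} _ = s≤s z≤n
    ∸-suc< : ∀ {k x} → 0 < k → k ∸ suc x < k
    ∸-suc< {suc k} {x} _ = s≤s (m∸n≤m k x)

-- B's indices are shifted by A's class sizes, so B's edge sums move up by m.
module _ {m n h : ℕ} (A : PathLabeling m h) (B : PathLabeling n h) where

  private
    module A = PathLabeling A
    module B = PathLabeling B

    q : ℕ → ℕ
    q t with t <? m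
    ... | yes _ = A.q t
    ... | no  _ = B.q (t ∸ m) + classSize m (odd t)

    q-first : ∀ {t} → t < m → q t ≡ A.q t
    q-first {t} t<m with t <? m
    ... | yes _   = refl
    ... | no  t≮m = ⊥-elim (t≮m t<m)

    q-second : ∀ u → q (m + u) ≡ B.q u + classSize m (odd (m + u))
    q-second u with m + u <? m
    ... | yes m+u<m = ⊥-elim (m+n≮m m u m+u<m)
    ... | no  _     = cong (λ x → B.q x + classSize m (odd (m + u))) (m+n∸m≡n m u)

    data Position (t : ℕ) : Set where
      first  : t < m → Position t
      second : ∀ u → t ≡ m + u → Position t

    position : ∀ t → Position t
    position t with t <? m
    ... | yes t<m = first t<m
    ... | no  t≮m = second (t ∸ m) (sym (m+[n∸m]≡n (≮⇒≥ t≮m)))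

    odd-second : ∀ u → odd m xor odd (m + u) ≡ odd u
    odd-second u = trans (cong (odd m xor_) (odd-+ m u)) (xor-cancelˡ (odd m) (odd u))

    classSize-second : ∀ u → classSize (m + n) (odd (m + u)) ≡ classSize m (odd (m + u)) + classSize n (odd u)
    classSize-second u = trans (classSize-+ m n _) (cong (λ c → classSize m (odd (m + u)) + classSize n c) (odd-second u))

    q-last : ∀ k → 0 < k → B.q (pred k) + suc h ≡ ⌈ k /2⌉ → q (pred (m + k)) + suc h ≡ ⌈ m + k /2⌉
    q-last (suc k) _ last rewrite +-suc m k = begin
      q (m + k) + suc h                               ≡⟨ cong (_+ suc h) (q-second k) ⟩
      B.q k + classSize m c + suc h                   ≡⟨ regroup (B.q k) (classSize m c) (suc h) ⟩
      classSize m c + (B.q k + suc h)                 ≡⟨ cong (classSize m c +_) (trans last (sym (classSize-last k))) ⟩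
      classSize m c + classSize (suc k) (odd k)       ≡⟨ cong (λ c′ → classSize m c + classSize (suc k) c′) (sym (odd-second k)) ⟩
      classSize m c + classSize (suc k) (odd m xor c) ≡⟨ sym (classSize-+ m (suc k) c) ⟩
      classSize (m + suc k) c                         ≡⟨ cong (λ x → classSize x c) (+-suc m k) ⟩
      classSize (suc (m + k)) (odd (m + k))           ≡⟨ classSize-last (m + k) ⟩
      ⌈ suc (m + k) /2⌉                               ∎
      where
      open ≡-Reasoning
      c : Bool
      c = odd (m + k)
      regroup : ∀ x y z → x + y + z ≡ y + (x + z)
      regroup = solve-∀

    q<classSize : ∀ {t} → t < m + n → q t < classSize (m + n) (odd t)
    q<classSize {t} t<m+n with position t
    ... | first t<m = begin-strict
      q t                           ≡⟨ q-first t<m ⟩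
      A.q t                         <⟨ A.q<classSize t<m ⟩
      classSize m (odd t)           ≤⟨ m≤m+n _ _ ⟩
      classSize m (odd t) + _       ≡⟨ sym (classSize-+ m n (odd t)) ⟩
      classSize (m + n) (odd t)     ∎
      where open ≤-Reasoning
    ... | second u refl = begin-strict
      q (m + u)                                     ≡⟨ q-second u ⟩
      B.q u + classSize m (odd (m + u))             <⟨ +-monoˡ-< _ (B.q<classSize (+-cancelˡ-< m u n t<m+n)) ⟩
      classSize n (odd u) + classSize m (odd (m + u)) ≡⟨ +-comm (classSize n (odd u)) _ ⟩
      classSize m (odd (m + u)) + classSize n (odd u) ≡⟨ sym (classSize-second u) ⟩
      classSize (m + n) (odd (m + u))               ∎
      where open ≤-Reasoning

    first≢second : ∀ {t u} → t < m → odd t ≡ odd (m + u) → A.q t ≢ B.q u + classSize m (odd (m + u))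
    first≢second {t} {u} t<m o eq = <-irrefl refl (<-≤-trans (A.q<classSize t<m) (begin
      classSize m (odd t)                   ≡⟨ cong (classSize m) o ⟩
      classSize m (odd (m + u))             ≤⟨ m≤n+m _ (B.q u) ⟩
      B.q u + classSize m (odd (m + u))     ≡⟨ sym eq ⟩
      A.q t                                 ∎))
      where open ≤-Reasoning

    q-injective : ∀ {t u} → t < m + n → u < m + n → odd t ≡ odd u → q t ≡ q u → t ≡ u
    q-injective {t} {u} t< u< o eq with position t | position u
    ... | first t<m | first u<m = A.q-injective t<m u<m o (trans (sym (q-first t<m)) (trans eq (q-first u<m)))
    ... | first t<m | second u′ refl = ⊥-elim (first≢second t<m o (trans (sym (q-first t<m)) (trans eq (q-second u′))))
    ... | second t′ refl | first u<m =
      ⊥-elim (first≢second u<m (sym o) (trans (sym (q-first u<m)) (trans (sym eq) (q-second t′))))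
    ... | second t′ refl | second u′ refl = cong (m +_) (B.q-injective (+-cancelˡ-< m t′ n t<) (+-cancelˡ-< m u′ n u<) o′
            (+-cancelʳ-≡ _ (B.q t′) (B.q u′) (trans (sym (q-second t′)) (trans eq (trans (q-second u′)
              (cong (λ c → B.q u′ + classSize m c) (sym o)))))))
      where
      o′ : odd t′ ≡ odd u′
      o′ = trans (sym (odd-second t′)) (trans (cong (odd m xor_) o) (odd-second u′))

    sum : ℕ → ℕ
    sum t = q t + q (suc t)

    sum-first : ∀ {t} → suc t < m → sum t ≡ A.q t + A.q (suc t)
    sum-first {t} t+1<m = cong₂ _+_ (q-first (<-trans (n<1+n t) t+1<m)) (q-first t+1<m)

    sum-bridge : ∀ {t} → suc t ≡ m → suc (sum t) ≡ m
    sum-bridge {t} t+1≡m = begin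
      suc (q t + q (suc t))                 ≡⟨ cong₂ (λ x y → suc (x + y)) (q-first t<m) (cong q t+1≡m+0) ⟩
      suc (A.q t + q (m + 0))               ≡⟨ cong (λ x → suc (A.q t + x)) (q-second 0) ⟩
      suc (A.q t + (B.q 0 + K (odd (m + 0)))) ≡⟨ cong₂ (λ x c → suc (A.q t + (x + K c))) B.q-head (cong odd (+-identityʳ m)) ⟩
      suc (A.q t + (h + K (odd m)))         ≡⟨ regroup (A.q t) h (K (odd m)) ⟩
      A.q t + suc h + K (odd m)             ≡⟨ cong (λ x → A.q x + suc h + K (odd m)) (cong pred t+1≡m) ⟩
      A.q (pred m) + suc h + K (odd m)      ≡⟨ cong (_+ K (odd m)) A.q-last ⟩
      ⌈ m /2⌉ + K (odd m)                   ≡⟨ ⌈n/2⌉+classSize-odd≡n m ⟩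
      m                                     ∎
      where
      open ≡-Reasoning
      t<m : t < m
      t<m = ≤-reflexive t+1≡m
      t+1≡m+0 : suc t ≡ m + 0
      t+1≡m+0 = trans t+1≡m (sym (+-identityʳ m))
      K : Bool → ℕ
      K = classSize m
      regroup : ∀ a b c → suc (a + (b + c)) ≡ a + suc b + c
      regroup = solve-∀

    sum-second : ∀ u → sum (m + u) ≡ m + (B.q u + B.q (suc u))
    sum-second u = begin
      q (m + u) + q (suc (m + u))                 ≡⟨ cong₂ _+_ (q-second u) (trans (cong q (sym (+-suc m u))) (q-second (suc u))) ⟩
      (B.q u + K c) + (B.q (suc u) + K (odd (m + suc u))) ≡⟨ cong (λ c′ → (B.q u + K c) + (B.q (suc u) + K c′)) (cong odd (+-suc m u)) ⟩
      (B.q u + K c) + (B.q (suc u) + K (not c))   ≡⟨ regroup (B.q u) (K c) (B.q (suc u)) (K (not c)) ⟩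
      (K c + K (not c)) + (B.q u + B.q (suc u))   ≡⟨ cong (_+ (B.q u + B.q (suc u))) (classSize-complement m c) ⟩
      m + (B.q u + B.q (suc u))                   ∎
      where
      open ≡-Reasoning
      c : Bool
      c = odd (m + u)
      K : Bool → ℕ
      K = classSize m
      regroup : ∀ a b x y → (a + b) + (x + y) ≡ (b + y) + (a + x)
      regroup = solve-∀

    data Edge (t : ℕ) : Set where
      first  : suc t < m → Edge t
      bridge : suc t ≡ m → Edge t
      second : ∀ u → t ≡ m + u → Edge t

    edge : ∀ t → Edge t
    edge t with position (suc t)
    ... | first t+1<m      = first t+1<m
    ... | second zero eq    = bridge (trans eq (+-identityʳ m))
    ... | second (suc u) eq = second u (suc-injective (trans eq (+-suc m u)))

    first≢bridge : ∀ {x y} → suc (suc x) ≤ m → suc y ≡ m → x ≢ y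
    first≢bridge x+2≤m y+1≡m refl = <-irrefl y+1≡m x+2≤m

    below≢second : ∀ {x y} → suc x ≤ m → m ≤ y → x ≢ y
    below≢second x<m m≤y refl = <-irrefl refl (<-≤-trans x<m m≤y)

    sum-injective : ∀ {t u} → suc t < m + n → suc u < m + n → sum t ≡ sum u → t ≡ u
    sum-injective {t} {u} t< u< eq with edge t | edge u
    ... | first t′ | first u′ = A.sum-injective t′ u′ (trans (sym (sum-first t′)) (trans eq (sum-first u′)))
    ... | first t′ | bridge u′ = ⊥-elim (first≢bridge (A.sum-bound t′) (sum-bridge u′) (trans (sym (sum-first t′)) eq))
    ... | first t′ | second u′ refl = ⊥-elim (below≢second (≤-trans (n≤1+n _) (A.sum-bound t′)) (m≤m+n m _)
                                        (trans (sym (sum-first t′)) (trans eq (sum-second u′))))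
    ... | bridge t′ | first u′ =
      ⊥-elim (first≢bridge (A.sum-bound u′) (sum-bridge t′) (trans (sym (sum-first u′)) (sym eq)))
    ... | bridge t′ | bridge u′ = suc-injective (trans t′ (sym u′))
    ... | bridge t′ | second u′ refl =
      ⊥-elim (below≢second (≤-reflexive (sum-bridge t′)) (m≤m+n m _) (trans eq (sum-second u′)))
    ... | second t′ refl | first u′ = ⊥-elim (below≢second (≤-trans (n≤1+n _) (A.sum-bound u′)) (m≤m+n m _)
                                        (trans (sym (sum-first u′)) (trans (sym eq) (sum-second t′))))
    ... | second t′ refl | bridge u′ =
      ⊥-elim (below≢second (≤-reflexive (sum-bridge u′)) (m≤m+n m _) (trans (sym eq) (sum-second t′)))
    ... | second t′ refl | second u′ refl = cong (m +_) (B.sum-injective (second< t<) (second< u<)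
            (+-cancelˡ-≡ m _ _ (trans (sym (sum-second t′)) (trans eq (sum-second u′)))))
      where
      second< : ∀ {v} → suc (m + v) < m + n → suc v < n
      second< {v} lt = +-cancelˡ-< m (suc v) n (subst (_< m + n) (sym (+-suc m v)) lt)

    sum-onto : ∀ {s} → suc s < m + n → ∃[ t ] suc t < m + n × sum t ≡ s
    sum-onto {s} s< with suc s <? m
    ... | yes s+1<m with A.sum-onto s+1<m
    ...   | t , t+1<m , eq = t , <-≤-trans t+1<m (m≤m+n m n) , trans (sum-first t+1<m) eq
    sum-onto {s} s< | no s+1≮m with suc s ≟ m
    ... | yes s+1≡m = s , s< , suc-injective (trans (sum-bridge s+1≡m) (sym s+1≡m))
    ... | no  s+1≢m with s≤s⁻¹ (≮∧≢⇒> s+1≮m s+1≢m)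
    ...   | m≤s with B.sum-onto (shifted< m≤s s<)
    ...     | u , u+1<n , eq = m + u , subst (_< m + n) (+-suc m u) (+-monoʳ-< m u+1<n) ,
                                trans (sum-second u) (trans (cong (m +_) eq) (m+[n∸m]≡n m≤s))

  concat : PathLabeling (m + n) h
  concat = record
    { q             = q
    ; q-head        = trans (q-first A.length-pos) A.q-head
    ; q-last        = q-last n B.length-pos B.q-last
    ; q<classSize   = q<classSize
    ; q-injective   = q-injective
    ; sum-injective = sum-injective
    ; sum-onto      = sum-onto
    }

-- The length n = 4h + 1 with h > 0 is not reached by the construction.
Labellable : ℕ → Set
Labellable n = ∀ h → suc (h + h) ≤ n → (n ≡ suc (h + h + (h + h)) → h ≡ 0) → PathLabeling n h

-- Peel off a zigzag on 2h + 1 vertices, or on 2h + 2 when the rest would be 4h + 1.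
zigzagThen : ∀ {h r} → (∀ {m} → m < suc (h + h) + r → Labellable m) → suc (h + h) ≤ r → PathLabeling (suc (h + h) + r) h
zigzagThen {h} {r} rec h<r = choose (r ≟ suc (h + h + (h + h))) (h ≟ 0)
  where
  oddFirst : (r ≡ suc (h + h + (h + h)) → h ≡ 0) → PathLabeling (suc (h + h) + r) h
  oddFirst exception = concat (zigzag-odd h) (rec (m<n+m r z<s) h h<r exception)

  evenFirst : r ≡ suc (h + h + (h + h)) → h ≢ 0 → PathLabeling (suc (h + h) + r) h
  evenFirst refl h≢0 = subst (λ k → PathLabeling k h) (regroup h)
    (concat (zigzag-even h) (rec 4h<n h 2h<4h (λ 4h≡ → ⊥-elim (1+n≢n (sym 4h≡)))))
    where
    regroup : ∀ h → suc (suc (h + h)) + (h + h + (h + h)) ≡ suc (h + h) + suc (h + h + (h + h))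
    regroup = solve-∀
    4h<n : h + h + (h + h) < suc (h + h) + suc (h + h + (h + h))
    4h<n = subst (h + h + (h + h) <_) (regroup h) (m<n+m _ {suc (suc (h + h))} z<s)
    2h<4h : suc (h + h) ≤ h + h + (h + h)
    2h<4h = m<m+n (h + h) (<-≤-trans (n≢0⇒n>0 h≢0) (m≤m+n h h))

  choose : Dec (r ≡ suc (h + h + (h + h))) → Dec (h ≡ 0) → PathLabeling (suc (h + h) + r) h
  choose (no r≢)  _         = oddFirst (λ r≡ → ⊥-elim (r≢ r≡))
  choose (yes _)  (yes h≡0) = oddFirst (λ _ → h≡0)
  choose (yes r≡) (no h≢0)  = evenFirst r≡ h≢0

shortPath : ∀ {n h} → suc (h + h) ≤ n → n ≤ suc (suc (h + h)) → PathLabeling n h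
shortPath {h = h} n≥ n≤ with m≤n⇒m<n∨m≡n n≥
... | inj₂ refl = zigzag-odd h
... | inj₁ n>   = subst (λ k → PathLabeling k h) (≤-antisym n> n≤) (zigzag-even h)

mirror-long : ∀ {n h h′} → h′ + suc h ≡ ⌈ n /2⌉ → n ≤ h + h + (h + h) → suc (suc (h′ + h′ + (h′ + h′))) ≤ n
mirror-long {n} {h} {h′} pair n≤4h = +-cancelʳ-≤ n _ n (begin
  suc (suc (h′ + h′ + (h′ + h′))) + n             ≤⟨ +-monoʳ-≤ _ n≤4h ⟩
  suc (suc (h′ + h′ + (h′ + h′))) + (h + h + (h + h)) ≡⟨ regroup h′ h ⟩
  suc (h′ + h′ + (h + h)) + suc (h′ + h′ + (h + h)) ≤⟨ +-mono-≤ half≤ half≤ ⟩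
  n + n                                            ∎)
  where
  open ≤-Reasoning
  regroup : ∀ x y → suc (suc (x + x + (x + x))) + (y + y + (y + y)) ≡ suc (x + x + (y + y)) + suc (x + x + (y + y))
  regroup = solve-∀
  half≤ : suc (h′ + h′ + (h + h)) ≤ n
  half≤ = s≤s⁻¹ (subst (_≤ suc n) (trans (cong (λ c → c + c) (sym pair)) (regroup′ h′ h)) (⌈n/2⌉+⌈n/2⌉≤1+n n))
    where
    regroup′ : ∀ x y → (x + suc y) + (x + suc y) ≡ suc (suc (x + x + (y + y)))
    regroup′ = solve-∀

middle-bound : ∀ {n h} → ¬ n ≤ suc (suc (h + h)) → ¬ suc (suc (h + h + (h + h))) ≤ n →
               (n ≡ suc (h + h + (h + h)) → h ≡ 0) → n ≤ h + h + (h + h)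
middle-bound {n} {h} notShort notLong exception with m≤n⇒m<n∨m≡n (s≤s⁻¹ (≰⇒> notLong))
... | inj₁ n<  = s≤s⁻¹ n<
... | inj₂ n≡ with exception n≡
...   | refl = ⊥-elim (notShort (subst (_≤ 2) (sym n≡) (s≤s z≤n)))

2h+1≤n⇒h<⌈n/2⌉ : ∀ {n h} → suc (h + h) ≤ n → h < ⌈ n /2⌉
2h+1≤n⇒h<⌈n/2⌉ {n} {h} n≥ with h <? ⌈ n /2⌉
... | yes h< = h<
... | no  h≮ = ⊥-elim (<-irrefl refl
                  (≤-trans n≥ (≤-trans (n≤⌈n/2⌉+⌈n/2⌉ n) (+-mono-≤ (≮⇒≥ h≮) (≮⇒≥ h≮)))))

longPath : ∀ {n} → (∀ {m} → m < n → Labellable m) → ∀ h → suc (suc (h + h + (h + h))) ≤ n → PathLabeling n h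
longPath {n} rec h long = subst (λ k → PathLabeling k h) split (zigzagThen (λ m< → rec (subst (_ <_) split m<)) h<r)
  where
  long′ : suc (h + h) + suc (h + h) ≤ n
  long′ = subst (_≤ n) (regroup h) long
    where
    regroup : ∀ h → suc (suc (h + h + (h + h))) ≡ suc (h + h) + suc (h + h)
    regroup = solve-∀
  split : suc (h + h) + (n ∸ suc (h + h)) ≡ n
  split = m+[n∸m]≡n (≤-trans (m≤m+n (suc (h + h)) (suc (h + h))) long′)
  h<r : suc (h + h) ≤ n ∸ suc (h + h)
  h<r = +-cancelˡ-≤ (suc (h + h)) _ _ (subst (_ ≤_) (sym split) long′)

-- Lengths 2h + 3, …, 4h are long for the mirrored index h′ = ⌈n/2⌉ − 1 − h.
pathLabeling : ∀ n → Labellable n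
pathLabeling = <-rec Labellable step
  where
  step : ∀ n → (∀ {m} → m < n → Labellable m) → Labellable n
  step n rec h n≥ exception with n ≤? suc (suc (h + h)) | suc (suc (h + h + (h + h))) ≤? n
  ... | yes short   | _          = shortPath n≥ short
  ... | no _        | yes long   = longPath rec h long
  ... | no notShort | no notLong = subst (PathLabeling n) (mirror-pair pair)
                                     (mirrorPath (longPath rec h′ (mirror-long pair (middle-bound notShort notLong exception))))
    where
    h′ : ℕ
    h′ = ⌈ n /2⌉ ∸ suc h
    pair : h′ + suc h ≡ ⌈ n /2⌉
    pair = m∸n+n≡m (2h+1≤n⇒h<⌈n/2⌉ n≥)

-- Split labelings of graphs

edgeSum : {V E : Set} → (E → V × V) → (V → ℕ) → E → ℕ
edgeSum ends idx e = idx (proj₁ (ends e)) + idx (proj₂ (ends e))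

record SplitLabeling (V E : Set) (ends : E → V × V) : Set where
  field
    side          : V → Bool
    idx           : V → ℕ
    size          : Bool → ℕ
    idx<size      : ∀ v → idx v < size (side v)
    idx-injective : ∀ u v → side u ≡ side v → idx u ≡ idx v → u ≡ v
    ends-split    : ∀ e → side (proj₁ (ends e)) ≡ not (side (proj₂ (ends e)))
    sum-injective : ∀ e e′ → edgeSum ends idx e ≡ edgeSum ends idx e′ → e ≡ e′
    sum-onto      : ∀ {s} → suc s < size false + size true → ∃[ e ] edgeSum ends idx e ≡ s

  total : ℕ
  total = size false + size true

  size-complement : ∀ c → size c + size (not c) ≡ total
  size-complement false = refl
  size-complement true  = +-comm (size true) (size false)

  ends-size : ∀ e → size (side (proj₁ (ends e))) + size (side (proj₂ (ends e))) ≡ total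
  ends-size e = trans (cong (λ c → size c + size (side (proj₂ (ends e)))) (ends-split e))
                      (trans (+-comm (size (not (side (proj₂ (ends e))))) _) (size-complement _))

  sum-bound : ∀ e → suc (suc (edgeSum ends idx e)) ≤ total
  sum-bound e = subst (suc (suc (edgeSum ends idx e)) ≤_) (ends-size e)
                      (pair-sum< (idx<size (proj₁ (ends e))) (idx<size (proj₂ (ends e))))

mirrorSplit : ∀ {V E ends} → SplitLabeling V E ends → SplitLabeling V E ends
mirrorSplit {V} {E} {ends} T = record
  { side          = side
  ; idx           = idx′
  ; size          = size
  ; idx<size      = λ v → mirror< (idx<size v)
  ; idx-injective = λ u v s≡ eq → idx-injective u v s≡
                      (mirror-injective (idx<size u) (subst (λ c → idx v < size c) (sym s≡) (idx<size v))
                        (trans eq (cong (λ c → size c ∸ suc (idx v)) (sym s≡))))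
  ; ends-split    = ends-split
  ; sum-injective = λ e e′ eq → sum-injective e e′ (complement-unique (sums e) (sums e′) eq)
  ; sum-onto      = onto
  }
  where
  open SplitLabeling T
  idx′ : V → ℕ
  idx′ v = size (side v) ∸ suc (idx v)

  sums : ∀ e → edgeSum ends idx′ e + suc (suc (edgeSum ends idx e)) ≡ total
  sums e = trans (mirror-sum (idx<size (proj₁ (ends e))) (idx<size (proj₂ (ends e)))) (ends-size e)

  onto : ∀ {s} → suc s < total → ∃[ e ] edgeSum ends idx′ e ≡ s
  onto s<N with complement s<N
  ... | x , x<N , unique with sum-onto x<N
  ...   | e , refl = e , unique (sums e)

∣x-[m∸y]∣≡m∸[x+y] : ∀ x y {m} → x + y ≤ m → ∣ x - (m ∸ y) ∣ ≡ m ∸ (x + y)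
∣x-[m∸y]∣≡m∸[x+y] x y {m} x+y≤m = begin
  ∣ x - (m ∸ y) ∣ ≡⟨ m≤n⇒∣m-n∣≡n∸m (m+n≤o⇒m≤o∸n x x+y≤m) ⟩
  m ∸ y ∸ x       ≡⟨ ∸-+-assoc m y x ⟩
  m ∸ (y + x)     ≡⟨ cong (m ∸_) (+-comm y x) ⟩
  m ∸ (x + y)     ∎
  where open ≡-Reasoning

toGraceful : ∀ {V E ends} m (T : SplitLabeling V E ends) → SplitLabeling.total T ≡ suc m → GracefulLabeling V E ends m
toGraceful {V} {E} {ends} m T total≡ = record
  { f         = f
  ; injective = λ {u} {v} → f-injective u v
  ; bounded   = bounded
  ; diff-in   = λ e → subst (1 ≤_) (sym (diff e)) (m<n⇒0<n∸m (sum<m e)) ,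
                       subst (_≤ m) (sym (diff e)) (m∸n≤m m (edgeSum ends idx e))
  ; diff-onto = onto
  }
  where
  open SplitLabeling T

  label : Bool → ℕ → ℕ
  label false i = i
  label true  i = m ∸ i

  f : V → ℕ
  f v = label (side v) (idx v)

  idx<size′ : ∀ {v c} → side v ≡ c → idx v < size c
  idx<size′ {v} refl = idx<size v

  idx≤m : ∀ v → idx v ≤ m
  idx≤m v = s≤s⁻¹ (≤-trans (idx<size v) (subst (size (side v) ≤_) (trans (size-complement (side v)) total≡) (m≤m+n _ _)))

  sum<m : ∀ e → edgeSum ends idx e < m
  sum<m e = s≤s⁻¹ (subst (suc (suc (edgeSum ends idx e)) ≤_) total≡ (sum-bound e))

  cross : ∀ {u v} → side u ≡ false → side v ≡ true → idx u + idx v < m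
  cross {u} {v} su sv = s≤s⁻¹ (subst (suc (suc (idx u + idx v)) ≤_) total≡ (pair-sum< (idx<size′ su) (idx<size′ sv)))

  f-injective : ∀ u v → f u ≡ f v → u ≡ v
  f-injective u v eq with side u in su | side v in sv
  ... | false | false = idx-injective u v (trans su (sym sv)) eq
  ... | true  | true  = idx-injective u v (trans su (sym sv)) (∸-cancelˡ-≡ (idx≤m u) (idx≤m v) eq)
  ... | false | true  = ⊥-elim (<-irrefl (subst (λ x → x + idx v ≡ m) (sym eq) (m∸n+n≡m (idx≤m v))) (cross su sv))
  ... | true  | false = ⊥-elim (<-irrefl (subst (λ x → x + idx u ≡ m) eq (m∸n+n≡m (idx≤m u))) (cross sv su))

  bounded : ∀ v → f v ≤ m
  bounded v with side v
  ... | false = idx≤m v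
  ... | true  = m∸n≤m m (idx v)

  diff : ∀ e → ∣ f (proj₁ (ends e)) - f (proj₂ (ends e)) ∣ ≡ m ∸ edgeSum ends idx e
  diff e with side (proj₁ (ends e)) | side (proj₂ (ends e)) | ends-split e
  ... | false | true  | _ = ∣x-[m∸y]∣≡m∸[x+y] (idx (proj₁ (ends e))) (idx (proj₂ (ends e))) (<⇒≤ (sum<m e))
  ... | true  | false | _ = trans (∣-∣-comm (m ∸ a) b)
                             (trans (∣x-[m∸y]∣≡m∸[x+y] b a (subst (_≤ m) (+-comm a b) (<⇒≤ (sum<m e))))
                                    (cong (m ∸_) (+-comm b a)))
    where
    a b : ℕ
    a = idx (proj₁ (ends e))
    b = idx (proj₂ (ends e))

  onto : ∀ k → 1 ≤ k → k ≤ m → ∃[ e ] ∣ f (proj₁ (ends e)) - f (proj₂ (ends e)) ∣ ≡ k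
  onto k 1≤k k≤m with sum-onto (subst (suc (m ∸ k) <_) (sym total≡) (s≤s (∸-monoʳ-< 1≤k k≤m)))
  ... | e , eq = e , trans (diff e) (trans (cong (m ∸_) eq) (m∸[m∸n]≡n k≤m))

-- Spiders

predPos-nothing : ∀ {n} {j : Fin n} → predPos j ≡ nothing → toℕ j ≡ 0
predPos-nothing {j = zero} _ = refl

predPos-just : ∀ {n} {j k : Fin n} → predPos j ≡ just k → toℕ j ≡ suc (toℕ k)
predPos-just {j = suc j} refl = cong suc (sym (toℕ-inject₁ j))

legEnds : ∀ {s} {ℓ : Fin s → ℕ} i (j : Fin (ℓ i)) →
          (toℕ j ≡ 0 × spiderEnds s ℓ (i , j) ≡ (nothing , just (i , j)))
          ⊎ ∃[ k ] toℕ j ≡ suc (toℕ k) × spiderEnds s ℓ (i , j) ≡ (just (i , k) , just (i , j))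
legEnds i j with predPos j in eq
... | nothing = inj₁ (predPos-nothing eq , refl)
... | just k  = inj₂ (k , predPos-just eq , refl)

module _ {s : ℕ} {ℓ : Fin (suc s) → ℕ} where

  embedV : SpiderV s (ℓ ∘ inject₁) → SpiderV (suc s) ℓ
  embedV nothing        = nothing
  embedV (just (i , j)) = just (inject₁ i , j)

  embedE : SpiderE s (ℓ ∘ inject₁) → SpiderE (suc s) ℓ
  embedE (i , j) = inject₁ i , j

  ends-embed : ∀ e → spiderEnds (suc s) ℓ (embedE e) ≡
               (embedV (proj₁ (spiderEnds s (ℓ ∘ inject₁) e)) , embedV (proj₂ (spiderEnds s (ℓ ∘ inject₁) e)))
  ends-embed (i , j) with predPos j
  ... | nothing = refl
  ... | just _  = refl

  data VertexView : SpiderV (suc s) ℓ → Set where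
    old : ∀ v → VertexView (embedV v)
    new : ∀ j → VertexView (just (fromℕ s , j))

  vertexView : ∀ v → VertexView v
  vertexView nothing        = old nothing
  vertexView (just (i , j)) = leg i (view i) j
    where
    leg : ∀ i → View i → (j : Fin (ℓ i)) → VertexView (just (i , j))
    leg .(fromℕ s)   ‵fromℕ            j = new j
    leg .(inject₁ i) (‵inj₁ {i = i} _) j = old (just (i , j))

  vertexView-embed : ∀ v → vertexView (embedV v) ≡ old v
  vertexView-embed nothing        = refl
  vertexView-embed (just (i , j)) rewrite view-inject₁ i = refl

  vertexView-new : ∀ j → vertexView (just (fromℕ s , j)) ≡ new j
  vertexView-new j rewrite view-fromℕ s = refl

  data EdgeView : SpiderE (suc s) ℓ → Set where
    old : ∀ e → EdgeView (embedE e)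
    new : ∀ j → EdgeView (fromℕ s , j)

  edgeView : ∀ e → EdgeView e
  edgeView (i , j) = leg i (view i) j
    where
    leg : ∀ i → View i → (j : Fin (ℓ i)) → EdgeView (i , j)
    leg .(fromℕ s)   ‵fromℕ            j = new j
    leg .(inject₁ i) (‵inj₁ {i = i} _) j = old (i , j)

  caseV : {A : Set} → (SpiderV s (ℓ ∘ inject₁) → A) → (Fin (ℓ (fromℕ s)) → A) → SpiderV (suc s) ℓ → A
  caseV f g v with vertexView v
  ... | old w = f w
  ... | new j = g j

  caseV-embed : ∀ {A : Set} (f : SpiderV s (ℓ ∘ inject₁) → A) g v → caseV f g (embedV v) ≡ f v
  caseV-embed f g v rewrite vertexView-embed v = refl

  caseV-new : ∀ {A : Set} (f : SpiderV s (ℓ ∘ inject₁) → A) g j → caseV f g (just (fromℕ s , j)) ≡ g j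
  caseV-new f g j rewrite vertexView-new j = refl

module _ {s : ℕ} {ℓ : Fin (suc s) → ℕ} {h : ℕ}
  (T : SplitLabeling (SpiderV s (ℓ ∘ inject₁)) (SpiderE s (ℓ ∘ inject₁)) (spiderEnds s (ℓ ∘ inject₁)))
  (P : PathLabeling (ℓ (fromℕ s)) h)
  (centre-side : SplitLabeling.side T nothing ≡ false)
  (centre-idx : SplitLabeling.idx T nothing + suc h ≡ SplitLabeling.size T false)
  where

  private
    module T = SplitLabeling T
    module P = PathLabeling P
    L N : ℕ
    L = ℓ (fromℕ s)
    N = T.total

    newSide : Fin L → Bool
    newSide j = not (odd (toℕ j))

    newIdx : Fin L → ℕ
    newIdx j = P.q (toℕ j) + T.size (newSide j)

    side′ : SpiderV (suc s) ℓ → Bool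
    side′ = caseV T.side newSide

    idx′ : SpiderV (suc s) ℓ → ℕ
    idx′ = caseV T.idx newIdx

    size′ : Bool → ℕ
    size′ c = T.size c + classSize L (not c)

    total′ : size′ false + size′ true ≡ N + L
    total′ = trans (regroup (T.size false) ⌊ L /2⌋ (T.size true) ⌈ L /2⌉) (cong (N +_) (⌊n/2⌋+⌈n/2⌉≡n L))
      where
      regroup : ∀ a b c d → (a + b) + (c + d) ≡ (a + c) + (b + d)
      regroup = solve-∀

    newIdx<size′ : ∀ j → newIdx j < size′ (newSide j)
    newIdx<size′ j = subst (newIdx j <_) (+-comm (classSize L (not (newSide j))) _)
      (+-monoˡ-< (T.size (newSide j)) (subst (λ c → P.q (toℕ j) < classSize L c) (sym (not-involutive (odd (toℕ j))))
        (P.q<classSize (toℕ<n j))))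

    idx′<size′ : ∀ v → idx′ v < size′ (side′ v)
    idx′<size′ v with vertexView v
    ... | old w = <-≤-trans (T.idx<size w) (m≤m+n _ _)
    ... | new j = newIdx<size′ j

    old-idx≢new : ∀ w j → T.side w ≡ newSide j → T.idx w ≢ newIdx j
    old-idx≢new w j s≡ i≡ = <-irrefl refl (<-≤-trans (T.idx<size w)
      (subst (λ x → T.size (T.side w) ≤ x) (sym i≡) (subst (λ c → T.size (T.side w) ≤ P.q (toℕ j) + T.size c) s≡
        (m≤n+m _ _))))

    idx′-injective : ∀ u v → side′ u ≡ side′ v → idx′ u ≡ idx′ v → u ≡ v
    idx′-injective u v s≡ i≡ with vertexView u | vertexView v
    ... | old w | old w′ = cong embedV (T.idx-injective w w′ s≡ i≡)
    ... | old w | new j  = ⊥-elim (old-idx≢new w j s≡ i≡)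
    ... | new j | old w  = ⊥-elim (old-idx≢new w j (sym s≡) (sym i≡))
    ... | new j | new j′ = cong (λ k → just (fromℕ s , k)) (toℕ-injective
            (P.q-injective (toℕ<n j) (toℕ<n j′) (not-injective s≡)
              (+-cancelʳ-≡ _ _ _ (trans i≡ (cong (λ c → P.q (toℕ j′) + T.size c) (sym s≡))))))

    side-old : ∀ v → side′ (embedV v) ≡ T.side v
    side-old = caseV-embed {ℓ = ℓ} T.side newSide

    idx-old : ∀ v → idx′ (embedV v) ≡ T.idx v
    idx-old = caseV-embed {ℓ = ℓ} T.idx newIdx

    idx-new : ∀ {j t} → toℕ j ≡ t → idx′ (just (fromℕ s , j)) ≡ P.q t + T.size (not (odd t))
    idx-new {j} refl = caseV-new {ℓ = ℓ} T.idx newIdx j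

    SplitAt : SpiderV (suc s) ℓ × SpiderV (suc s) ℓ → Set
    SplitAt (u , v) = side′ u ≡ not (side′ v)

    side-new : ∀ {j t} → toℕ j ≡ t → side′ (just (fromℕ s , j)) ≡ not (odd t)
    side-new {j} refl = caseV-new {ℓ = ℓ} T.side newSide j

    ends-split′ : ∀ e → SplitAt (spiderEnds (suc s) ℓ e)
    ends-split′ e with edgeView e
    ... | old e₀ = subst SplitAt (sym (ends-embed e₀))
                     (trans (side-old _) (trans (T.ends-split e₀) (cong not (sym (side-old _)))))
    ... | new j with legEnds {ℓ = ℓ} (fromℕ s) j
    ...   | inj₁ (j≡0 , ends≡) = subst SplitAt (sym ends≡) (trans centre-side (cong not (sym (side-new j≡0))))
    ...   | inj₂ (k , j≡k+1 , ends≡) = subst SplitAt (sym ends≡)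
                                         (trans (side-new refl) (sym (trans (cong not (side-new j≡k+1)) (not-involutive _))))

    sum′ : SpiderE (suc s) ℓ → ℕ
    sum′ = edgeSum (spiderEnds (suc s) ℓ) idx′

    sum-old : ∀ e → sum′ (embedE e) ≡ edgeSum (spiderEnds s (ℓ ∘ inject₁)) T.idx e
    sum-old e = trans (cong (edgeSum id idx′) (ends-embed e)) (cong₂ _+_ (idx-old _) (idx-old _))

    data NewEdge (j : Fin L) : Set where
      bridge : toℕ j ≡ 0 → suc (sum′ (fromℕ s , j)) ≡ N → NewEdge j
      along  : ∀ t → toℕ j ≡ suc t → suc t < L → sum′ (fromℕ s , j) ≡ N + (P.q t + P.q (suc t)) → NewEdge j

    newEdge : ∀ j → NewEdge j
    newEdge j with legEnds {ℓ = ℓ} (fromℕ s) j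
    ... | inj₁ (j≡0 , ends≡) = bridge j≡0 (begin
      suc (sum′ (fromℕ s , j))                 ≡⟨ cong (λ p → suc (edgeSum id idx′ p)) ends≡ ⟩
      suc (x + idx′ (just (fromℕ s , j)))      ≡⟨ cong (λ y → suc (x + y)) (idx-new j≡0) ⟩
      suc (x + (P.q 0 + T.size true))          ≡⟨ cong (λ y → suc (x + (y + T.size true))) P.q-head ⟩
      suc (x + (h + T.size true))              ≡⟨ regroup x h (T.size true) ⟩
      x + suc h + T.size true                  ≡⟨ cong (_+ T.size true) centre-idx ⟩
      N                                        ∎)
      where
      open ≡-Reasoning
      x : ℕ
      x = T.idx nothing
      regroup : ∀ a b c → suc (a + (b + c)) ≡ a + suc b + c
      regroup = solve-∀
    ... | inj₂ (k , j≡k+1 , ends≡) = along t j≡k+1 (subst (_< L) j≡k+1 (toℕ<n j)) (begin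
      sum′ (fromℕ s , j)                                     ≡⟨ cong (edgeSum id idx′) ends≡ ⟩
      idx′ (just (fromℕ s , k)) + idx′ (just (fromℕ s , j))   ≡⟨ cong₂ _+_ (idx-new refl) (idx-new j≡k+1) ⟩
      (P.q t + T.size c) + (P.q (suc t) + T.size (not c))     ≡⟨ regroup (P.q t) (T.size c) (P.q (suc t)) (T.size (not c)) ⟩
      (T.size c + T.size (not c)) + (P.q t + P.q (suc t))     ≡⟨ cong (_+ (P.q t + P.q (suc t))) (T.size-complement c) ⟩
      N + (P.q t + P.q (suc t))                               ∎)
      where
      open ≡-Reasoning
      t : ℕ
      t = toℕ k
      c : Bool
      c = not (odd t)
      regroup : ∀ a b x y → (a + b) + (x + y) ≡ (b + y) + (a + x)
      regroup = solve-∀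

    old<N : ∀ e → suc (sum′ (embedE e)) < N
    old<N e = subst (λ x → suc (suc x) ≤ N) (sym (sum-old e)) (T.sum-bound e)

    old-sum≢new : ∀ e j → sum′ (embedE e) ≢ sum′ (fromℕ s , j)
    old-sum≢new e j with newEdge j
    ... | bridge _ sum≡  = <⇒≢ (s≤s⁻¹ (subst (suc (suc (sum′ (embedE e))) ≤_) (sym sum≡) (old<N e)))
    ... | along _ _ _ sum≡ = <⇒≢ (<-≤-trans (<-trans (n<1+n _) (old<N e)) (subst (N ≤_) (sym sum≡) (m≤m+n N _)))

    bridge≢along : ∀ j j′ {x} → suc (sum′ (fromℕ s , j)) ≡ N → sum′ (fromℕ s , j′) ≡ N + x →
                   sum′ (fromℕ s , j) ≢ sum′ (fromℕ s , j′)
    bridge≢along _ _ sum≡ sum′≡ = <⇒≢ (<-≤-trans (≤-reflexive sum≡) (subst (N ≤_) (sym sum′≡) (m≤m+n N _)))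

    new-injective : ∀ j j′ → sum′ (fromℕ s , j) ≡ sum′ (fromℕ s , j′) → j ≡ j′
    new-injective j j′ eq with newEdge j | newEdge j′
    ... | bridge j≡0 _ | bridge j′≡0 _ = toℕ-injective (trans j≡0 (sym j′≡0))
    ... | bridge _ sum≡ | along _ _ _ sum′≡ = ⊥-elim (bridge≢along j j′ sum≡ sum′≡ eq)
    ... | along _ _ _ sum≡ | bridge _ sum′≡ = ⊥-elim (bridge≢along j′ j sum′≡ sum≡ (sym eq))
    ... | along t j≡ t< sum≡ | along t′ j′≡ t′< sum′≡ = toℕ-injective (trans j≡ (trans (cong suc
            (P.sum-injective t< t′< (+-cancelˡ-≡ N _ _ (trans (sym sum≡) (trans eq sum′≡))))) (sym j′≡)))

    sum′-injective : ∀ e e′ → sum′ e ≡ sum′ e′ → e ≡ e′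
    sum′-injective e e′ eq with edgeView e | edgeView e′
    ... | old e₀ | old e₀′ = cong embedE (T.sum-injective e₀ e₀′ (trans (sym (sum-old e₀)) (trans eq (sum-old e₀′))))
    ... | old e₀ | new j   = ⊥-elim (old-sum≢new e₀ j eq)
    ... | new j  | old e₀  = ⊥-elim (old-sum≢new e₀ j (sym eq))
    ... | new j  | new j′  = cong (fromℕ s ,_) (new-injective j j′ eq)

    sum′-onto : ∀ {r} → suc r < N + L → ∃[ e ] sum′ e ≡ r
    sum′-onto {r} r< with suc r <? N
    ... | yes r<N with T.sum-onto r<N
    ...   | e , sum≡ = embedE e , trans (sum-old e) sum≡
    sum′-onto {r} r< | no r≮N with suc r ≟ N
    ... | yes r+1≡N with newEdge (fromℕ< P.length-pos)
    ...   | bridge _ sum≡ = (fromℕ s , fromℕ< P.length-pos) , suc-injective (trans sum≡ (sym r+1≡N))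
    ...   | along _ 0≡ _ _ = ⊥-elim (0≢1+n (trans (sym (toℕ-fromℕ< P.length-pos)) 0≡))
    sum′-onto {r} r< | no r≮N | no r+1≢N with s≤s⁻¹ (≮∧≢⇒> r≮N r+1≢N)
    ... | N≤r with P.sum-onto (shifted< N≤r r<)
    ...   | t , t< , psum≡ with newEdge (fromℕ< t<)
    ...     | bridge 0≡ _ = ⊥-elim (0≢1+n (trans (sym 0≡) (toℕ-fromℕ< t<)))
    ...     | along t′ j≡ _ sum≡ = (fromℕ s , fromℕ< t<) , (begin
        sum′ (fromℕ s , fromℕ< t<)    ≡⟨ sum≡ ⟩
        N + (P.q t′ + P.q (suc t′))   ≡⟨ cong (λ x → N + (P.q x + P.q (suc x))) t′≡t ⟩
        N + (P.q t + P.q (suc t))     ≡⟨ cong (N +_) psum≡ ⟩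
        N + (r ∸ N)                   ≡⟨ m+[n∸m]≡n N≤r ⟩
        r                             ∎)
        where
        open ≡-Reasoning
        t′≡t : t′ ≡ t
        t′≡t = suc-injective (trans (sym j≡) (toℕ-fromℕ< t<))

  attachLeg : SplitLabeling (SpiderV (suc s) ℓ) (SpiderE (suc s) ℓ) (spiderEnds (suc s) ℓ)
  attachLeg = record
    { side          = side′
    ; idx           = idx′
    ; size          = size′
    ; idx<size      = idx′<size′
    ; idx-injective = idx′-injective
    ; ends-split    = ends-split′
    ; sum-injective = sum′-injective
    ; sum-onto      = λ {r} r< → sum′-onto (subst (suc r <_) total′ r<)
    }

  attachLeg-total : SplitLabeling.total attachLeg ≡ N + L
  attachLeg-total = total′

record CentredLabeling (s : ℕ) (ℓ : Fin s → ℕ) : Set where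
  field
    labeling    : SplitLabeling (SpiderV s ℓ) (SpiderE s ℓ) (spiderEnds s ℓ)
    centre-side : SplitLabeling.side labeling nothing ≡ false
    total≡      : SplitLabeling.total labeling ≡ suc (legSum s ℓ)

  open SplitLabeling labeling public

emptyCentred : (ℓ : Fin 0 → ℕ) → CentredLabeling 0 ℓ
emptyCentred ℓ = record
  { labeling    = record
    { side          = λ _ → false
    ; idx           = λ _ → 0
    ; size          = λ { false → 1 ; true → 0 }
    ; idx<size      = λ _ → s≤s z≤n
    ; idx-injective = λ { nothing nothing _ _ → refl }
    ; ends-split    = λ { (() , _) }
    ; sum-injective = λ { (() , _) }
    ; sum-onto      = λ { (s≤s ()) }
    }
  ; centre-side = refl
  ; total≡      = refl
  }

mirrorCentred : ∀ {s ℓ} → CentredLabeling s ℓ → CentredLabeling s ℓ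
mirrorCentred C = record
  { labeling = mirrorSplit labeling ; centre-side = centre-side ; total≡ = total≡ }
  where open CentredLabeling C

legSum-last : ∀ s (ℓ : Fin (suc s) → ℕ) → legSum (suc s) ℓ ≡ legSum s (ℓ ∘ inject₁) + ℓ (fromℕ s)
legSum-last zero    ℓ = +-identityʳ (ℓ zero)
legSum-last (suc s) ℓ = trans (cong (ℓ zero +_) (legSum-last s (ℓ ∘ suc))) (sym (+-assoc (ℓ zero) _ _))

extend : ∀ {s} {ℓ : Fin (suc s) → ℕ} (C : CentredLabeling s (ℓ ∘ inject₁)) {h} →
         CentredLabeling.idx C nothing + suc h ≡ CentredLabeling.size C false →
         PathLabeling (ℓ (fromℕ s)) h → CentredLabeling (suc s) ℓ
extend {s} {ℓ} C centre-idx P = record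
  { labeling    = attachLeg {ℓ = ℓ} labeling P centre-side centre-idx
  ; centre-side = centre-side
  ; total≡      = trans (attachLeg-total {ℓ = ℓ} labeling P centre-side centre-idx)
                        (trans (cong (_+ ℓ (fromℕ s)) total≡) (cong suc (sym (legSum-last s ℓ))))
  }
  where open CentredLabeling C

centre-balanced : ∀ {x n} → x < n → (∃[ h ] x + suc h ≡ n × suc (h + h) ≤ n) ⊎ suc (x + x) ≤ n
centre-balanced {x} {n} x<n with suc (x + x) ≤? n
... | yes x-short = inj₂ x-short
... | no  x-long  = inj₁ (h , pair , +-cancelʳ-≤ n _ _ (begin
  suc (h + h) + n           ≤⟨ +-monoʳ-≤ (suc (h + h)) (<⇒≤ (≰⇒> x-long)) ⟩
  suc (h + h) + suc (x + x) ≡⟨ regroup h x ⟩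
  (h + suc x) + (h + suc x) ≡⟨ cong₂ _+_ (+-comm h (suc x)) (+-comm h (suc x)) ⟩
  (suc x + h) + (suc x + h) ≡⟨ cong₂ _+_ pair′ pair′ ⟩
  n + n                     ∎))
  where
  open ≤-Reasoning
  h : ℕ
  h = n ∸ suc x
  pair′ : suc x + h ≡ n
  pair′ = m+[n∸m]≡n x<n
  pair : x + suc h ≡ n
  pair = trans (+-suc x h) pair′
  regroup : ∀ h x → suc (h + h) + suc (x + x) ≡ (h + suc x) + (h + suc x)
  regroup = solve-∀

double-cancel-≤ : ∀ {a b} → a + a ≤ b + b → a ≤ b
double-cancel-≤ {a} {b} le with a ≤? b
... | yes a≤b = a≤b
... | no  a≰b = ⊥-elim (<-irrefl refl (<-≤-trans (+-mono-< (≰⇒> a≰b) (≰⇒> a≰b)) le))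

centreClass-bound : ∀ {c p L} → c ≤ p → 2 * p + 2 ≤ L → c + ⌊ L /2⌋ ≤ L
centreClass-bound {c} {p} {L} c≤p chain = double-cancel-≤ (begin
  (c + ⌊ L /2⌋) + (c + ⌊ L /2⌋) ≡⟨ regroup c ⌊ L /2⌋ ⟩
  (c + c) + (⌊ L /2⌋ + ⌊ L /2⌋) ≤⟨ +-mono-≤ c+c≤L (+-monoʳ-≤ ⌊ L /2⌋ (⌊n/2⌋≤⌈n/2⌉ L)) ⟩
  L + (⌊ L /2⌋ + ⌈ L /2⌉)       ≡⟨ cong (L +_) (⌊n/2⌋+⌈n/2⌉≡n L) ⟩
  L + L                         ∎)
  where
  open ≤-Reasoning
  c+c≤L : c + c ≤ L
  c+c≤L = ≤-trans (+-mono-≤ c≤p (≤-trans c≤p (m≤m+n p 0))) (≤-trans (m≤m+n (2 * p) 2) chain)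
  regroup : ∀ a b → (a + b) + (a + b) ≡ (a + a) + (b + b)
  regroup = solve-∀

leg-long : ∀ {h c p L} → suc (h + h) ≤ c → c ≤ p → 2 * p + 2 ≤ L → 4 + (h + h + (h + h)) ≤ L
leg-long {h} {c} {p} {L} h-short c≤p chain =
  subst (_≤ L) (regroup h) (≤-trans (+-monoˡ-≤ 2 (+-mono-≤ h≤p (≤-trans h≤p (m≤m+n p 0)))) chain)
  where
  h≤p : suc (h + h) ≤ p
  h≤p = ≤-trans h-short c≤p
  regroup : ∀ h → suc (h + h) + suc (h + h) + 2 ≡ 4 + (h + h + (h + h))
  regroup = solve-∀

CentreBounded : ∀ s (ℓ : Fin (suc s) → ℕ) → Set
CentreBounded s ℓ = Σ (CentredLabeling (suc s) ℓ) λ C → CentredLabeling.size C false ≤ ℓ (fromℕ s)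

extendBalanced : ∀ {s} {ℓ : Fin (suc s) → ℕ} {p} (C : CentredLabeling s (ℓ ∘ inject₁)) →
                 CentredLabeling.size C false ≤ p → 2 * p + 2 ≤ ℓ (fromℕ s) →
                 ∀ h → CentredLabeling.idx C nothing + suc h ≡ CentredLabeling.size C false →
                 suc (h + h) ≤ CentredLabeling.size C false → CentreBounded s ℓ
extendBalanced {s} {ℓ} C c≤p chain h centre-idx h-short =
  extend C centre-idx (pathLabeling (ℓ (fromℕ s)) h 2h<L exception) , centreClass-bound c≤p chain
  where
  long : 4 + (h + h + (h + h)) ≤ ℓ (fromℕ s)
  long = leg-long {h} h-short c≤p chain
  2h<L : suc (h + h) ≤ ℓ (fromℕ s)
  2h<L = ≤-trans (s≤s (m≤m+n (h + h) (h + h))) (≤-trans (m≤n+m _ 3) long)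
  exception : ℓ (fromℕ s) ≡ suc (h + h + (h + h)) → h ≡ 0
  exception L≡ = ⊥-elim (<-irrefl refl (≤-trans (m≤n+m _ 2) (subst (4 + (h + h + (h + h)) ≤_) L≡ long)))

grow : ∀ {s} {ℓ : Fin (suc s) → ℕ} {p} (C : CentredLabeling s (ℓ ∘ inject₁)) → CentredLabeling.size C false ≤ p →
       2 * p + 2 ≤ ℓ (fromℕ s) → CentreBounded s ℓ
grow {s} {ℓ} C c≤p chain = balance (centre-balanced x<c)
  where
  open CentredLabeling C
  x : ℕ
  x = idx nothing
  x<c : x < size false
  x<c = subst (λ c → x < size c) centre-side (idx<size nothing)
  mirrored : size (side nothing) ∸ suc x + suc x ≡ size false
  mirrored = subst (λ c → size c ∸ suc x + suc x ≡ size false) (sym centre-side) (m∸n+n≡m x<c)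
  balance : (∃[ h ] x + suc h ≡ size false × suc (h + h) ≤ size false) ⊎ suc (x + x) ≤ size false → CentreBounded s ℓ
  balance (inj₁ (h , centre-idx , h-short)) = extendBalanced C c≤p chain h centre-idx h-short
  balance (inj₂ x-short)                    = extendBalanced (mirrorCentred C) c≤p chain x mirrored x-short

spiderLabeling : ∀ s (ℓ : Fin (suc s) → ℕ) → 1 ≤ ℓ zero → (∀ k → 2 * ℓ (inject₁ k) + 2 ≤ ℓ (suc k)) →
                 CentreBounded s ℓ
spiderLabeling zero ℓ ℓ₀≥1 _ =
  extend (emptyCentred _) refl (pathLabeling (ℓ zero) 0 ℓ₀≥1 (λ _ → refl)) , first ℓ₀≥1
  where
  first : ∀ {n} → 1 ≤ n → suc ⌊ n /2⌋ ≤ n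
  first {suc n} _ = s≤s (⌈n/2⌉≤n n)
spiderLabeling (suc s) ℓ ℓ₀≥1 chain with spiderLabeling s (ℓ ∘ inject₁) ℓ₀≥1 (chain ∘ inject₁)
... | C , c≤p = grow C c≤p (chain (fromℕ s))

theorem1p4 : (t : ℕ) (ℓ : Fin (suc (suc t)) → ℕ)
    → (∀ i → 1 ≤ ℓ i)
    → (∀ (k : Fin t) → 2 * ℓ (suc (inject₁ k)) + 2 ≤ ℓ (suc (suc k)))
    → (ℓ (suc zero) % 4 ≢ 1 → 2 * ℓ zero + 2 ≤ ℓ (suc zero))
    → (ℓ (suc zero) % 4 ≡ 1 → 2 * ℓ zero + 4 ≤ ℓ (suc zero))
    → SpiderGraceful (suc (suc t)) ℓ
theorem1p4 t ℓ positive chain second-leg second-leg-1mod4 =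
  toGraceful _ (CentredLabeling.labeling C) (CentredLabeling.total≡ C)
  where
  chain′ : ∀ (k : Fin (suc t)) → 2 * ℓ (inject₁ k) + 2 ≤ ℓ (suc k)
  chain′ zero with ℓ (suc zero) % 4 ≟ 1
  ... | yes ≡1 = ≤-trans (+-monoʳ-≤ (2 * ℓ zero) (s≤s (s≤s z≤n))) (second-leg-1mod4 ≡1)
  ... | no  ≢1 = second-leg ≢1
  chain′ (suc k) = chain k

  C : CentredLabeling (suc (suc t)) ℓ
  C = proj₁ (spiderLabeling (suc t) ℓ (positive zero) chain′)
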